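{- If a quiver $Q$ is torsion-free, then it admits a minimal extension.
   Context: A quiver is a finite directed graph with no directed cycles of length 1 or 2. For a quiver $Q$ with vertices $1,\dots,n$, $B(Q)$ is the $n\times n$ skew-symmetric matrix $b_{ij}=\#\{\text{arrows } i\to j\}-\#\{\text{arrows } j\to i\}$, and $\operatorname{cork}(Q)=n-\operatorname{rk}B(Q)$. An ice quiver $\tilde Q$ with mutable vertices $1,\dots,n$ and frozen vertices $n+1,\dots,n+m$ (no arrows between frozen vertices) has $(n+m)\times n$ exchange matrix $\tilde B$ defined by the same formula; its mutable part is the induced subquiver on $1,\dots,n$. $\tilde Q$ is really full rank if the rows of $\tilde B$ span $\mathbb Z^n$ over $\mathbb Z$. $Q$ is torsion-free if $\mathbb Z^n/B(Q)^T\mathbb Z^n$ is torsion-free. A minimal extension of $Q$ is an ice quiver with mutable part $Q$, exactly $\operatorname{cork}(Q)$ frozen vertices, which is really full rank. -}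

module Defs where

open import Data.Nat using (ℕ; zero; suc; _+_; _∸_; _≤_)
open import Data.Integer as ℤ using (ℤ; +_; 0ℤ)
open import Data.Fin using (Fin; zero; suc; _↑ˡ_; _↑ʳ_)
open import Data.Product using (Σ; _×_; ∃)
open import Relation.Binary.PropositionalEquality using (_≡_; _≢_)
open import Relation.Nullary using (¬_)

sumℤ : ∀ {k} → (Fin k → ℤ) → ℤ
sumℤ {zero}  f = 0ℤ
sumℤ {suc k} f = f zero ℤ.+ sumℤ (λ i → f (suc i))

record Quiver (n : ℕ) : Set where
  field
    arrows   : Fin n → Fin n → ℕ
    noLoop   : ∀ i → arrows i i ≡ 0
    no2cycle : ∀ i j → arrows i j ≢ 0 → arrows j i ≡ 0
open Quiver public

B : ∀ {n} → Quiver n → Fin n → Fin n → ℤ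
B Q i j = (+ arrows Q i j) ℤ.- (+ arrows Q j i)

rowComb : ∀ {r n} → (Fin r → Fin n → ℤ) → (Fin r → ℤ) → Fin n → ℤ
rowComb M c j = sumℤ (λ i → c i ℤ.* M i j)

-- The rows of M selected by s : Fin k → Fin r are linearly independent over ℤ
-- (equivalently over ℚ).
RowsIndependent : ∀ {r n k} → (Fin r → Fin n → ℤ) → (Fin k → Fin r) → Set
RowsIndependent M s =
  ∀ (c : _ → ℤ) → (∀ j → rowComb (λ i → M (s i)) c j ≡ 0ℤ) → ∀ i → c i ≡ 0ℤ

-- rank M = ρ : some ρ rows are linearly independent, and any family of ρ+1
-- rows is linearly dependent (rank over ℚ, i.e. maximal number of independent rows).
HasRank : ∀ {r n} → (Fin r → Fin n → ℤ) → ℕ → Set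
HasRank {r} M ρ =
  Σ (Fin ρ → Fin r) (λ s → RowsIndependent M s) ×
  (∀ (s : Fin (suc ρ) → Fin r) → ¬ RowsIndependent M s)

HasCorank : ∀ {n} → Quiver n → ℕ → Set
HasCorank {n} Q κ = Σ ℕ (λ ρ → HasRank (B Q) ρ × κ ≡ n ∸ ρ)

InRowSpan : ∀ {r n} → (Fin r → Fin n → ℤ) → (Fin n → ℤ) → Set
InRowSpan M v = Σ (_ → ℤ) (λ c → ∀ j → rowComb M c j ≡ v j)

-- Z^n / B(Q)^T Z^n is torsion-free  (B(Q)^T Z^n = ℤ-span of the rows of B(Q)).
TorsionFree : ∀ {n} → Quiver n → Set
TorsionFree {n} Q =
  ∀ (v : Fin n → ℤ) (k : ℤ) → k ≢ 0ℤ →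
    InRowSpan (B Q) (λ j → k ℤ.* v j) → InRowSpan (B Q) v

-- Ice quiver: vertices Fin (n + m); mutable = (i ↑ˡ m), frozen = raise n j;
-- no arrows between frozen vertices.
record IceQuiver (n m : ℕ) : Set where
  field
    quiver   : Quiver (n + m)
    noFrozen : ∀ (a b : Fin m) → arrows quiver ((n ↑ʳ a)) ((n ↑ʳ b)) ≡ 0
open IceQuiver public

exchangeMatrix : ∀ {n m} → IceQuiver n m → Fin (n + m) → Fin n → ℤ
exchangeMatrix {n} {m} Q̃ i j = B (quiver Q̃) i ((j ↑ˡ m))

MutablePartIs : ∀ {n m} → IceQuiver n m → Quiver n → Set
MutablePartIs {n} {m} Q̃ Q =
  ∀ i j → arrows (quiver Q̃) ((i ↑ˡ m)) ((j ↑ˡ m)) ≡ arrows Q i j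

ReallyFullRank : ∀ {n m} → IceQuiver n m → Set
ReallyFullRank {n} Q̃ = ∀ (v : Fin n → ℤ) → InRowSpan (exchangeMatrix Q̃) v

MinimalExtension : ∀ {n} → Quiver n → Set
MinimalExtension {n} Q =
  Σ ℕ (λ m → HasCorank Q m × Σ (IceQuiver n m) (λ Q̃ → MutablePartIs Q̃ Q × ReallyFullRank Q̃))

{-# OPTIONS --safe #-}
-- Process the rows of B(Q) one at a time, maintaining a basis (uⱼ) of ℤⁿ whose indices are
-- split into pivots and free ones: the rows processed so far have vanishing free coordinates,
-- some of them are in echelon form on the pivot coordinates, and every pivot vector uⱼ lies in
-- the row lattice L of B(Q).  For a new row v, Euclid's algorithm on its free coordinates
-- (unimodular changes of two basis vectors at a time) leaves at most one of them nonzero, say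
-- g at u.  If g ≠ 0 then g u = v − (pivot part of v) lies in L, so u ∈ L because L is
-- saturated (this is torsion-freeness), and u becomes a new pivot.  In the end the pivots count
-- the rank, and the free basis vectors, taken as exchange rows of the frozen vertices, complete
-- L to all of ℤⁿ.
module Submission where

open import Defs
open import Data.Nat as ℕ using (ℕ; zero; suc)
import Data.Nat.Properties as ℕ
open import Data.Integer as ℤ using (ℤ; +_; -[1+_]; 0ℤ; 1ℤ; _+_; _*_; -_; _-_)
import Data.Integer.Properties as ℤ
open import Data.Integer.DivMod using (_/_; _%_; a≡a%n+[a/n]*n; n%d<d)
open import Data.Integer.Solver using (module +-*-Solver)
open import Data.Fin using (Fin; zero; suc; punchIn; punchOut; _↑ˡ_; _↑ʳ_; splitAt)
import Data.Fin.Properties as Fin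
open import Data.Vec.Functional using (Vector; _∷_; tail; updateAt; insertAt)
open import Data.Vec.Functional.Properties using (updateAt-updates; updateAt-minimal; insertAt-lookup; insertAt-punchIn)
open import Algebra.Properties.Semiring.Sum ℤ.+-*-semiring
  using (sum; ∑-distrib-+; ∑-comm; *-distribˡ-sum; *-distribʳ-sum; sum-remove)
open import Data.Product using (∃; ∃₂; _×_; _,_; proj₁; proj₂)
open import Data.Sum using (_⊎_; inj₁; inj₂)
open import Data.Empty using (⊥-elim)
open import Data.Unit using (⊤; tt)
open import Function using (_∘_; const)
open import Relation.Nullary using (¬_; yes; no)
open import Relation.Nullary.Decidable using (_⊎-dec_)
open import Relation.Unary using (Pred; Decidable; _⊆_)
open import Level using (0ℓ)
open import Function.Definitions using (Injective)
open import Relation.Binary.PropositionalEquality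
open +-*-Solver
open ≡-Reasoning

-- Finite sums

sumℤ≡sum : ∀ {k} (f : Vector ℤ k) → sumℤ f ≡ sum f
sumℤ≡sum {zero}  f = refl
sumℤ≡sum {suc k} f = cong (λ s → f zero + s) (sumℤ≡sum (tail f))

sumℤ-cong : ∀ {k} {f g : Vector ℤ k} → f ≗ g → sumℤ f ≡ sumℤ g
sumℤ-cong {zero}  f≗g = refl
sumℤ-cong {suc k} f≗g = cong₂ _+_ (f≗g zero) (sumℤ-cong (f≗g ∘ suc))

sumℤ-zero : ∀ {k} {f : Vector ℤ k} → (∀ i → f i ≡ 0ℤ) → sumℤ f ≡ 0ℤ
sumℤ-zero {zero}  f≡0 = refl
sumℤ-zero {suc k} f≡0 = cong₂ _+_ (f≡0 zero) (sumℤ-zero (f≡0 ∘ suc))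

sumℤ-+ : ∀ {k} (f g : Vector ℤ k) → sumℤ (λ i → f i + g i) ≡ sumℤ f + sumℤ g
sumℤ-+ f g = begin
  sumℤ (λ i → f i + g i) ≡⟨ sumℤ≡sum (λ i → f i + g i) ⟩
  sum (λ i → f i + g i)  ≡⟨ ∑-distrib-+ f g ⟩
  sum f + sum g          ≡⟨ sym (cong₂ _+_ (sumℤ≡sum f) (sumℤ≡sum g)) ⟩
  sumℤ f + sumℤ g        ∎

*-distribˡ-sumℤ : ∀ {k} x (f : Vector ℤ k) → x * sumℤ f ≡ sumℤ (λ i → x * f i)
*-distribˡ-sumℤ x f = begin
  x * sumℤ f            ≡⟨ cong (x *_) (sumℤ≡sum f) ⟩
  x * sum f             ≡⟨ *-distribˡ-sum x f ⟩
  sum (λ i → x * f i)   ≡⟨ sym (sumℤ≡sum (λ i → x * f i)) ⟩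
  sumℤ (λ i → x * f i)  ∎

*-distribʳ-sumℤ : ∀ {k} x (f : Vector ℤ k) → sumℤ f * x ≡ sumℤ (λ i → f i * x)
*-distribʳ-sumℤ x f = begin
  sumℤ f * x            ≡⟨ cong (_* x) (sumℤ≡sum f) ⟩
  sum f * x             ≡⟨ *-distribʳ-sum x f ⟩
  sum (λ i → f i * x)   ≡⟨ sym (sumℤ≡sum (λ i → f i * x)) ⟩
  sumℤ (λ i → f i * x)  ∎

sumℤ-combine : ∀ {k} a b (x y : Vector ℤ k) →
                sumℤ (λ i → a * x i + b * y i) ≡ a * sumℤ x + b * sumℤ y
sumℤ-combine a b x y = begin
  sumℤ (λ i → a * x i + b * y i)               ≡⟨ sumℤ-+ (λ i → a * x i) (λ i → b * y i) ⟩
  sumℤ (λ i → a * x i) + sumℤ (λ i → b * y i)  ≡⟨ sym (cong₂ _+_ (*-distribˡ-sumℤ a x) (*-distribˡ-sumℤ b y)) ⟩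
  a * sumℤ x + b * sumℤ y                      ∎

sumℤ-comm : ∀ {k l} (f : Fin k → Fin l → ℤ) →
            sumℤ (λ i → sumℤ (f i)) ≡ sumℤ (λ j → sumℤ (λ i → f i j))
sumℤ-comm f = begin
  sumℤ (λ i → sumℤ (f i))              ≡⟨ sumℤ-cong (λ i → sumℤ≡sum (f i)) ⟩
  sumℤ (λ i → sum (f i))               ≡⟨ sumℤ≡sum (λ i → sum (f i)) ⟩
  sum (λ i → sum (f i))                ≡⟨ ∑-comm f ⟩
  sum (λ j → sum (λ i → f i j))        ≡⟨ sym (sumℤ≡sum (λ j → sum (λ i → f i j))) ⟩
  sumℤ (λ j → sum (λ i → f i j))       ≡⟨ sym (sumℤ-cong (λ j → sumℤ≡sum (λ i → f i j))) ⟩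
  sumℤ (λ j → sumℤ (λ i → f i j))      ∎

sumℤ-remove : ∀ {k} (f : Vector ℤ (suc k)) p → sumℤ f ≡ f p + sumℤ (f ∘ punchIn p)
sumℤ-remove f p = begin
  sumℤ f                     ≡⟨ sumℤ≡sum f ⟩
  sum f                      ≡⟨ sum-remove {i = p} f ⟩
  f p + sum (f ∘ punchIn p)  ≡⟨ cong (λ s → f p + s) (sym (sumℤ≡sum (f ∘ punchIn p))) ⟩
  f p + sumℤ (f ∘ punchIn p) ∎

sumℤ-single : ∀ {k} (f : Vector ℤ k) p → (∀ j → j ≢ p → f j ≡ 0ℤ) → sumℤ f ≡ f p
sumℤ-single {suc k} f p f≡0 = begin
  sumℤ f                      ≡⟨ sumℤ-remove f p ⟩
  f p + sumℤ (f ∘ punchIn p)  ≡⟨ cong (λ s → f p + s) (sumℤ-zero (λ i → f≡0 _ (Fin.punchInᵢ≢i p i))) ⟩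
  f p + 0ℤ                    ≡⟨ ℤ.+-identityʳ (f p) ⟩
  f p                         ∎

sumℤ-twoPoints : ∀ {k} (f g : Vector ℤ k) {p q} → p ≢ q →
                 (∀ j → j ≢ p → j ≢ q → f j ≡ g j) → f p + f q ≡ g p + g q →
                 sumℤ f ≡ sumℤ g
sumℤ-twoPoints {suc zero} f g {zero} {zero} p≢q _ _ = ⊥-elim (p≢q refl)
sumℤ-twoPoints {suc (suc k)} f g {p} {q} p≢q f≗g fp+fq≡gp+gq = begin
  sumℤ f                   ≡⟨ split f ⟩
  (f p + f q) + rest f     ≡⟨ cong₂ _+_ fp+fq≡gp+gq (sumℤ-cong rest-agree) ⟩
  (g p + g q) + rest g     ≡⟨ sym (split g) ⟩
  sumℤ g                   ∎
  where
  q′ : Fin (suc k)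
  q′ = punchOut p≢q
  other : Fin k → Fin (suc (suc k))
  other = punchIn p ∘ punchIn q′
  rest : Vector ℤ (suc (suc k)) → ℤ
  rest h = sumℤ (h ∘ other)
  split : ∀ h → sumℤ h ≡ (h p + h q) + rest h
  split h = begin
    sumℤ h                                        ≡⟨ sumℤ-remove h p ⟩
    h p + sumℤ (h ∘ punchIn p)                     ≡⟨ cong (λ s → h p + s) (sumℤ-remove (h ∘ punchIn p) q′) ⟩
    h p + (h (punchIn p q′) + rest h)              ≡⟨ cong (λ x → h p + (h x + rest h)) (Fin.punchIn-punchOut p≢q) ⟩
    h p + (h q + rest h)                           ≡⟨ sym (ℤ.+-assoc (h p) (h q) (rest h)) ⟩
    (h p + h q) + rest h                           ∎
  rest-agree : ∀ i → f (other i) ≡ g (other i)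
  rest-agree i = f≗g (other i) (Fin.punchInᵢ≢i p _) λ other≡q →
    Fin.punchInᵢ≢i q′ i (Fin.punchIn-injective p _ _ (trans other≡q (sym (Fin.punchIn-punchOut p≢q))))

unit : ∀ {k} → Fin k → Vector ℤ k
unit i = updateAt (const 0ℤ) i (const 1ℤ)

unit-diag : ∀ {k} (i : Fin k) → unit i i ≡ 1ℤ
unit-diag i = updateAt-updates i (const 0ℤ)

unit-off : ∀ {k} {i j : Fin k} → j ≢ i → unit i j ≡ 0ℤ
unit-off {i = i} {j} j≢i = updateAt-minimal j i (const 0ℤ) j≢i

rowComb-unit : ∀ {k n} (W : Fin k → Vector ℤ n) i → rowComb W (unit i) ≗ W i
rowComb-unit W i j = begin
  sumℤ (λ i′ → unit i i′ * W i′ j)  ≡⟨ sumℤ-single _ i (λ i′ i′≢i → trans (cong (_* W i′ j) (unit-off i′≢i)) (ℤ.*-zeroˡ (W i′ j))) ⟩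
  unit i i * W i j                  ≡⟨ cong (_* W i j) (unit-diag i) ⟩
  1ℤ * W i j                        ≡⟨ ℤ.*-identityˡ (W i j) ⟩
  W i j                             ∎

rowComb-units : ∀ {k} (c : Vector ℤ k) → rowComb unit c ≗ c
rowComb-units c j = begin
  sumℤ (λ i → c i * unit i j)  ≡⟨ sumℤ-single _ j (λ i i≢j → trans (cong (c i *_) (unit-off (≢-sym i≢j))) (ℤ.*-zeroʳ (c i))) ⟩
  c j * unit j j               ≡⟨ cong (c j *_) (unit-diag j) ⟩
  c j * 1ℤ                     ≡⟨ ℤ.*-identityʳ (c j) ⟩
  c j                          ∎

-- Row spans and bases

Saturated : ∀ {r n} → (Fin r → Vector ℤ n) → Set
Saturated {n = n} M =
  ∀ (v : Vector ℤ n) (k : ℤ) → k ≢ 0ℤ → InRowSpan M (λ j → k * v j) → InRowSpan M v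

module _ {r n} (M : Fin r → Vector ℤ n) where

  span-cong : ∀ {v w} → v ≗ w → InRowSpan M v → InRowSpan M w
  span-cong v≗w (c , Mc≗v) = c , λ j → trans (Mc≗v j) (v≗w j)

  span-zero : InRowSpan M (const 0ℤ)
  span-zero = const 0ℤ , λ j → sumℤ-zero (λ i → ℤ.*-zeroˡ (M i j))

  span-+ : ∀ {v w} → InRowSpan M v → InRowSpan M w → InRowSpan M (λ j → v j + w j)
  span-+ {v} {w} (c , Mc≗v) (d , Md≗w) = (λ i → c i + d i) , λ j → begin
    sumℤ (λ i → (c i + d i) * M i j)         ≡⟨ sumℤ-cong (λ i → ℤ.*-distribʳ-+ (M i j) (c i) (d i)) ⟩
    sumℤ (λ i → c i * M i j + d i * M i j)   ≡⟨ sumℤ-+ (λ i → c i * M i j) (λ i → d i * M i j) ⟩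
    rowComb M c j + rowComb M d j            ≡⟨ cong₂ _+_ (Mc≗v j) (Md≗w j) ⟩
    v j + w j                                ∎

  span-scale : ∀ x {v} → InRowSpan M v → InRowSpan M (λ j → x * v j)
  span-scale x {v} (c , Mc≗v) = (λ i → x * c i) , λ j → begin
    sumℤ (λ i → x * c i * M i j)    ≡⟨ sumℤ-cong (λ i → ℤ.*-assoc x (c i) (M i j)) ⟩
    sumℤ (λ i → x * (c i * M i j))  ≡⟨ sym (*-distribˡ-sumℤ x (λ i → c i * M i j)) ⟩
    x * rowComb M c j               ≡⟨ cong (x *_) (Mc≗v j) ⟩
    x * v j                         ∎

  span-− : ∀ {v w} → InRowSpan M v → InRowSpan M w → InRowSpan M (λ j → v j - w j)
  span-− v∈M w∈M = span-+ v∈M (span-cong (λ j → ℤ.-1*i≡-i _) (span-scale (- 1ℤ) w∈M))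

  span-row : ∀ i → InRowSpan M (M i)
  span-row i = unit i , rowComb-unit M i

  span-rowComb : ∀ {k} (W : Fin k → Vector ℤ n) c →
                 (∀ i → c i ≡ 0ℤ ⊎ InRowSpan M (W i)) → InRowSpan M (rowComb W c)
  span-rowComb {zero}  W c _ = span-zero
  span-rowComb {suc k} W c spanned =
    span-+ (leading (spanned zero)) (span-rowComb (W ∘ suc) (c ∘ suc) (spanned ∘ suc))
    where
    leading : c zero ≡ 0ℤ ⊎ InRowSpan M (W zero) → InRowSpan M (λ j → c zero * W zero j)
    leading (inj₁ c≡0) = span-cong (λ j → sym (trans (cong (_* W zero j) c≡0) (ℤ.*-zeroˡ (W zero j)))) span-zero
    leading (inj₂ W∈M) = span-scale (c zero) W∈M

  span-⊆ : ∀ {k} (W : Fin k → Vector ℤ n) → (∀ i → InRowSpan M (W i)) →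
           ∀ {v} → InRowSpan W v → InRowSpan M v
  span-⊆ W W⊆M (c , Wc≗v) = span-cong Wc≗v (span-rowComb W c (inj₂ ∘ W⊆M))

record Basis (n : ℕ) : Set where
  field
    vec         : Fin n → Vector ℤ n
    coordMatrix : Fin n → Fin n → ℤ
    expand      : ∀ w → rowComb vec (rowComb coordMatrix w) ≗ w
open Basis public

coord : ∀ {n} → Basis n → Vector ℤ n → Vector ℤ n
coord B = rowComb (coordMatrix B)

standardBasis : ∀ n → Basis n
standardBasis n = record
  { vec         = unit
  ; coordMatrix = unit
  ; expand      = λ w k → trans (rowComb-units (rowComb unit w) k) (rowComb-units w k)
  }

coord-rowComb : ∀ {n k} (B : Basis n) (W : Fin k → Vector ℤ n) c →
                coord B (rowComb W c) ≗ rowComb (coord B ∘ W) c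
coord-rowComb B W c j = begin
  sumℤ (λ l → rowComb W c l * V l j)             ≡⟨ sumℤ-cong (λ l → *-distribʳ-sumℤ (V l j) (λ i → c i * W i l)) ⟩
  sumℤ (λ l → sumℤ (λ i → c i * W i l * V l j))  ≡⟨ sumℤ-comm (λ l i → c i * W i l * V l j) ⟩
  sumℤ (λ i → sumℤ (λ l → c i * W i l * V l j))  ≡⟨ sumℤ-cong (λ i → sumℤ-cong (λ l → ℤ.*-assoc (c i) (W i l) (V l j))) ⟩
  sumℤ (λ i → sumℤ (λ l → c i * (W i l * V l j))) ≡⟨ sumℤ-cong (λ i → sym (*-distribˡ-sumℤ (c i) (λ l → W i l * V l j))) ⟩
  rowComb (coord B ∘ W) c j                      ∎
  where V = coordMatrix B

coord≡0⇒≡0 : ∀ {n} (B : Basis n) {w} → (∀ j → coord B w j ≡ 0ℤ) → ∀ k → w k ≡ 0ℤ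
coord≡0⇒≡0 B {w} coord≡0 k = begin
  w k                                    ≡⟨ sym (expand B w k) ⟩
  sumℤ (λ j → coord B w j * vec B j k)   ≡⟨ sumℤ-zero (λ j → trans (cong (_* vec B j k) (coord≡0 j)) (ℤ.*-zeroˡ (vec B j k))) ⟩
  0ℤ                                     ∎

≡0⇒coord≡0 : ∀ {n} (B : Basis n) {w} → (∀ k → w k ≡ 0ℤ) → ∀ j → coord B w j ≡ 0ℤ
≡0⇒coord≡0 B w≡0 j = sumℤ-zero (λ k → trans (cong (_* coordMatrix B k j) (w≡0 k)) (ℤ.*-zeroˡ (coordMatrix B k j)))

rowComb-erase : ∀ {k n} (W : Fin k → Vector ℤ n) c p →
                rowComb W c ≗ λ j → c p * W p j + rowComb W (updateAt c p (const 0ℤ)) j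
rowComb-erase {suc k} W c p j = begin
  rowComb W c j
    ≡⟨ sumℤ-remove (λ i → c i * W i j) p ⟩
  c p * W p j + others c
    ≡⟨ cong (λ s → c p * W p j + s) (sym (ℤ.+-identityˡ _)) ⟩
  c p * W p j + (0ℤ + others c)
    ≡⟨ cong (λ s → c p * W p j + s) (cong₂ _+_ (sym (ℤ.*-zeroˡ (W p j))) (sumℤ-cong erased-others)) ⟩
  c p * W p j + (0ℤ * W p j + others c′)
    ≡⟨ cong (λ s → c p * W p j + (s * W p j + others c′)) (sym (updateAt-updates p c)) ⟩
  c p * W p j + (c′ p * W p j + others c′)
    ≡⟨ cong (λ s → c p * W p j + s) (sym (sumℤ-remove (λ i → c′ i * W i j) p)) ⟩
  c p * W p j + rowComb W c′ j ∎
  where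
  c′ : Vector ℤ (suc k)
  c′ = updateAt c p (const 0ℤ)
  others : Vector ℤ (suc k) → ℤ
  others d = sumℤ (λ i → d (punchIn p i) * W (punchIn p i) j)
  erased-others : ∀ i → c (punchIn p i) * W (punchIn p i) j ≡ c′ (punchIn p i) * W (punchIn p i) j
  erased-others i = cong (_* W (punchIn p i) j) (sym (updateAt-minimal _ p c (Fin.punchInᵢ≢i p i)))

span-byCoords : ∀ {r n} (M : Fin r → Vector ℤ n) (B : Basis n) {w} →
                (∀ j → coord B w j ≡ 0ℤ ⊎ InRowSpan M (vec B j)) → InRowSpan M w
span-byCoords M B {w} spanned = span-cong M (expand B w) (span-rowComb M (vec B) (coord B w) spanned)

-- Elementary changes of basis

mix : ∀ {n} (p q : Fin n) (a b c e : ℤ) → Vector ℤ n → Vector ℤ n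
mix p q a b c e x = updateAt (updateAt x p (const (a * x p + b * x q))) q (const (c * x p + e * x q))

rowComb-affine : ∀ {k n} (W : Fin k → Vector ℤ n) c (f : Vector ℤ k) a b {j₁ j₂} →
                 (∀ i → f i ≡ a * W i j₁ + b * W i j₂) →
                 sumℤ (λ i → c i * f i) ≡ a * rowComb W c j₁ + b * rowComb W c j₂
rowComb-affine W c f a b {j₁} {j₂} f≡ = begin
  sumℤ (λ i → c i * f i)                                  ≡⟨ sumℤ-cong (λ i → trans (cong (c i *_) (f≡ i)) (distribute a b (c i) (W i j₁) (W i j₂))) ⟩
  sumℤ (λ i → a * (c i * W i j₁) + b * (c i * W i j₂))    ≡⟨ sumℤ-combine a b (λ i → c i * W i j₁) (λ i → c i * W i j₂) ⟩
  a * rowComb W c j₁ + b * rowComb W c j₂                 ∎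
  where
  distribute : ∀ a b x y z → x * (a * y + b * z) ≡ a * (x * y) + b * (x * z)
  distribute = solve 5 (λ a b x y z → x :* (a :* y :+ b :* z) := a :* (x :* y) :+ b :* (x :* z)) refl

module _ {n} {p q : Fin n} (p≢q : p ≢ q) where

  mix-p : ∀ a b c e x → mix p q a b c e x p ≡ a * x p + b * x q
  mix-p a b c e x = trans (updateAt-minimal p q _ p≢q) (updateAt-updates p x)

  mix-q : ∀ a b c e x → mix p q a b c e x q ≡ c * x p + e * x q
  mix-q a b c e x = updateAt-updates q _

  mix-off : ∀ a b c e x {j} → j ≢ p → j ≢ q → mix p q a b c e x j ≡ x j
  mix-off a b c e x {j} j≢p j≢q = trans (updateAt-minimal j q _ j≢q) (updateAt-minimal j p x j≢p)

  mix-rowComb : ∀ a b c e {k} (W : Fin k → Vector ℤ n) d →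
                rowComb (mix p q a b c e ∘ W) d ≗ mix p q a b c e (rowComb W d)
  mix-rowComb a b c e W d j with j Fin.≟ p | j Fin.≟ q
  ... | yes refl | _ = trans (rowComb-affine W d _ a b (mix-p a b c e ∘ W)) (sym (mix-p a b c e _))
  ... | no _ | yes refl = trans (rowComb-affine W d _ c e (mix-q a b c e ∘ W)) (sym (mix-q a b c e _))
  ... | no j≢p | no j≢q = trans (sumℤ-cong (λ i → cong (d i *_) (mix-off a b c e (W i) j≢p j≢q)))
                                (sym (mix-off a b c e _ j≢p j≢q))

  -- (e, -c; -b, a) is the inverse transpose of (a, b; c, e).
  mix-pairing : ∀ a b c e → a * e - b * c ≡ 1ℤ → ∀ x y →
                sumℤ (λ j → mix p q e (- c) (- b) a x j * mix p q a b c e y j) ≡ sumℤ (λ j → x j * y j)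
  mix-pairing a b c e det x y = sumℤ-twoPoints _ _ p≢q
    (λ j j≢p j≢q → cong₂ _*_ (mix-off e (- c) (- b) a x j≢p j≢q) (mix-off a b c e y j≢p j≢q))
    (begin
      x′ p * y′ p + x′ q * y′ q
        ≡⟨ cong₂ _+_ (cong₂ _*_ (mix-p e (- c) (- b) a x) (mix-p a b c e y))
                     (cong₂ _*_ (mix-q e (- c) (- b) a x) (mix-q a b c e y)) ⟩
      (e * x p + - c * x q) * (a * y p + b * y q) + (- b * x p + a * x q) * (c * y p + e * y q)
        ≡⟨ expand-pairing a b c e (x p) (x q) (y p) (y q) ⟩
      (a * e - b * c) * (x p * y p + x q * y q)
        ≡⟨ cong (_* (x p * y p + x q * y q)) det ⟩
      1ℤ * (x p * y p + x q * y q)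
        ≡⟨ ℤ.*-identityˡ _ ⟩
      x p * y p + x q * y q ∎)
    where
    x′ y′ : Vector ℤ n
    x′ = mix p q e (- c) (- b) a x
    y′ = mix p q a b c e y
    expand-pairing : ∀ a b c e xp xq yp yq →
      (e * xp + - c * xq) * (a * yp + b * yq) + (- b * xp + a * xq) * (c * yp + e * yq)
        ≡ (a * e - b * c) * (xp * yp + xq * yq)
    expand-pairing = solve 8 (λ a b c e xp xq yp yq →
      (e :* xp :+ :- c :* xq) :* (a :* yp :+ b :* yq) :+ (:- b :* xp :+ a :* xq) :* (c :* yp :+ e :* yq)
        := (a :* e :- b :* c) :* (xp :* yp :+ xq :* yq)) refl

  mixBasis : Basis n → (a b c e : ℤ) → a * e - b * c ≡ 1ℤ → Basis n
  mixBasis B a b c e det = record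
    { vec         = λ j k → mix p q a b c e (λ i → vec B i k) j
    ; coordMatrix = mix p q e (- c) (- b) a ∘ coordMatrix B
    ; expand      = λ w k → begin
        sumℤ (λ j → rowComb (mix p q e (- c) (- b) a ∘ coordMatrix B) w j * mix p q a b c e (λ i → vec B i k) j)
          ≡⟨ sumℤ-cong (λ j → cong (_* _) (mix-rowComb e (- c) (- b) a (coordMatrix B) w j)) ⟩
        sumℤ (λ j → mix p q e (- c) (- b) a (coord B w) j * mix p q a b c e (λ i → vec B i k) j)
          ≡⟨ mix-pairing a b c e det (coord B w) (λ i → vec B i k) ⟩
        sumℤ (λ j → coord B w j * vec B j k)
          ≡⟨ expand B w k ⟩
        w k ∎
    }

record ChangeWithin {n} (S : Pred (Fin n) 0ℓ) (B B′ : Basis n) : Set where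
  field
    vec-off   : ∀ {j} → ¬ S j → vec B′ j ≗ vec B j
    coord-off : ∀ {j} → ¬ S j → ∀ w → coord B′ w j ≡ coord B w j
    zero-on   : ∀ w → (∀ {j} → S j → coord B w j ≡ 0ℤ) → ∀ {j} → S j → coord B′ w j ≡ 0ℤ
open ChangeWithin public

module _ {n} {S : Pred (Fin n) 0ℓ} where

  changeWithin-refl : ∀ {B} → ChangeWithin S B B
  changeWithin-refl = record
    { vec-off = λ _ _ → refl ; coord-off = λ _ _ → refl ; zero-on = λ _ coord≡0 → coord≡0 }

  changeWithin-trans : ∀ {B₁ B₂ B₃} → ChangeWithin S B₁ B₂ → ChangeWithin S B₂ B₃ → ChangeWithin S B₁ B₃
  changeWithin-trans ch ch′ = record
    { vec-off   = λ ¬Sj k → trans (vec-off ch′ ¬Sj k) (vec-off ch ¬Sj k)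
    ; coord-off = λ ¬Sj w → trans (coord-off ch′ ¬Sj w) (coord-off ch ¬Sj w)
    ; zero-on   = λ w coord≡0 → zero-on ch′ w (zero-on ch w coord≡0)
    }

  changeWithin-widen : ∀ {T B B′} → S ⊆ T → Decidable S → ChangeWithin S B B′ → ChangeWithin T B B′
  changeWithin-widen {T} {B} {B′} S⊆T S? ch = record
    { vec-off   = λ ¬Tj → vec-off ch (¬Tj ∘ S⊆T)
    ; coord-off = λ ¬Tj → coord-off ch (¬Tj ∘ S⊆T)
    ; zero-on   = zero-on′
    }
    where
    zero-on′ : ∀ w → (∀ {j} → T j → coord B w j ≡ 0ℤ) → ∀ {j} → T j → coord B′ w j ≡ 0ℤ
    zero-on′ w coord≡0 {j} Tj with S? j
    ... | yes Sj  = zero-on ch w (coord≡0 ∘ S⊆T) Sj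
    ... | no ¬Sj  = trans (coord-off ch ¬Sj w) (coord≡0 Tj)

Pair : ∀ {n} → Fin n → Fin n → Pred (Fin n) 0ℓ
Pair p q j = j ≡ p ⊎ j ≡ q

Image : ∀ {k n} → (Fin k → Fin n) → Pred (Fin n) 0ℓ
Image τ j = ∃ λ b → τ b ≡ j

mixBasis-changeWithin : ∀ {n} {p q : Fin n} (p≢q : p ≢ q) B a b c e det →
                        ChangeWithin (Pair p q) B (mixBasis p≢q B a b c e det)
mixBasis-changeWithin {p = p} {q} p≢q B a b c e det = record
  { vec-off   = λ ¬pair k → mix-off p≢q a b c e _ (¬pair ∘ inj₁) (¬pair ∘ inj₂)
  ; coord-off = λ ¬pair w → trans (mix-rowComb p≢q e (- c) (- b) a (coordMatrix B) w _)
                                  (mix-off p≢q e (- c) (- b) a _ (¬pair ∘ inj₁) (¬pair ∘ inj₂))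
  ; zero-on   = zero-on′
  }
  where
  vanish : ∀ x y → x * 0ℤ + y * 0ℤ ≡ 0ℤ
  vanish = solve 2 (λ x y → x :* con 0ℤ :+ y :* con 0ℤ := con 0ℤ) refl
  zero-on′ : ∀ w → (∀ {j} → Pair p q j → coord B w j ≡ 0ℤ) →
             ∀ {j} → Pair p q j → coord (mixBasis p≢q B a b c e det) w j ≡ 0ℤ
  zero-on′ w coord≡0 {j} pair = begin
    coord (mixBasis p≢q B a b c e det) w j          ≡⟨ mix-rowComb p≢q e (- c) (- b) a (coordMatrix B) w j ⟩
    mix p q e (- c) (- b) a (coord B w) j           ≡⟨ at pair ⟩
    0ℤ ∎
    where
    at : Pair p q j → mix p q e (- c) (- b) a (coord B w) j ≡ 0ℤ
    at (inj₁ refl) = trans (mix-p p≢q e (- c) (- b) a _)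
                           (trans (cong₂ (λ x y → e * x + - c * y) (coord≡0 (inj₁ refl)) (coord≡0 (inj₂ refl))) (vanish e (- c)))
    at (inj₂ refl) = trans (mix-q p≢q e (- c) (- b) a _)
                           (trans (cong₂ (λ x y → - b * x + a * y) (coord≡0 (inj₁ refl)) (coord≡0 (inj₂ refl))) (vanish (- b) a))

-- Euclidean reduction of coordinates

module _ {n} {p q : Fin n} (p≢q : p ≢ q) (v : Vector ℤ n) where

  clearCoordinate : ∀ fuel (B : Basis n) → ℤ.∣ coord B v q ∣ ℕ.< fuel →
                    ∃ λ B′ → ChangeWithin (Pair p q) B B′ × coord B′ v q ≡ 0ℤ
  clearCoordinate (suc fuel) B bound with coord B v q ℤ.≟ 0ℤ
  ... | yes vq≡0 = B , changeWithin-refl , vq≡0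
  ... | no vq≢0 =
    let B″ , ch , cleared = clearCoordinate fuel B′ bound′
    in  B″ , changeWithin-trans (mixBasis-changeWithin p≢q B k 1ℤ (- 1ℤ) 0ℤ det) ch , cleared
    where
    α β : ℤ
    α = coord B v p
    β = coord B v q
    instance
      β-nonZero : ℤ.NonZero β
      β-nonZero = ℤ.≢-nonZero vq≢0
    k : ℤ
    k = α / β
    det : k * 0ℤ - 1ℤ * (- 1ℤ) ≡ 1ℤ
    det = solve 1 (λ k → k :* con 0ℤ :- con 1ℤ :* (:- con 1ℤ) := con 1ℤ) refl k
    B′ : Basis n
    B′ = mixBasis p≢q B k 1ℤ (- 1ℤ) 0ℤ det
    remainder : coord B′ v q ≡ - (+ (α % β))
    remainder = begin
      coord B′ v q                        ≡⟨ mix-rowComb p≢q 0ℤ (- (- 1ℤ)) (- 1ℤ) k (coordMatrix B) v q ⟩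
      mix p q 0ℤ (- (- 1ℤ)) (- 1ℤ) k (coord B v) q ≡⟨ mix-q p≢q 0ℤ (- (- 1ℤ)) (- 1ℤ) k (coord B v) ⟩
      - 1ℤ * α + k * β                    ≡⟨ cong (λ a → - 1ℤ * a + k * β) (a≡a%n+[a/n]*n α β) ⟩
      - 1ℤ * (+ (α % β) + k * β) + k * β  ≡⟨ cancel (+ (α % β)) k β ⟩
      - (+ (α % β))                       ∎
      where
      cancel : ∀ r k β → - 1ℤ * (r + k * β) + k * β ≡ - r
      cancel = solve 3 (λ r k β → :- con 1ℤ :* (r :+ k :* β) :+ k :* β := :- r) refl
    bound′ : ℤ.∣ coord B′ v q ∣ ℕ.< fuel
    bound′ = subst (ℕ._< fuel) (sym (trans (cong ℤ.∣_∣ remainder) (ℤ.∣-i∣≡∣i∣ (+ (α % β)))))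
                   (ℕ.<-≤-trans (n%d<d α β) (ℕ.≤-pred bound))

concentrate : ∀ {n k} (B : Basis n) (τ : Fin (suc k) → Fin n) → Injective _≡_ _≡_ τ → (v : Vector ℤ n) →
              ∃ λ B′ → ChangeWithin (Image τ) B B′ × (∀ b → coord B′ v (τ (suc b)) ≡ 0ℤ)
concentrate {k = zero} B τ τ-injective v = B , changeWithin-refl , λ ()
concentrate {n} {suc k} B τ τ-injective v
  with clearCoordinate {p = τ zero} {q = τ (suc zero)} (Fin.0≢1+n ∘ τ-injective) v _ B (ℕ.n<1+n _)
... | B₁ , ch₁ , q-cleared
  with concentrate B₁ (τ ∘ punchIn (suc zero)) (Fin.punchIn-injective (suc zero) _ _ ∘ τ-injective) v
... | B₂ , ch₂ , rest-cleared =
  B₂ ,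
  changeWithin-trans (changeWithin-widen pair⊆image pair? ch₁) (changeWithin-widen image′⊆image image′? ch₂) ,
  λ { zero → trans (coord-off ch₂ q∉image′ v) q-cleared ; (suc b) → rest-cleared b }
  where
  p q : Fin n
  p = τ zero
  q = τ (suc zero)
  τ′ : Fin (suc k) → Fin n
  τ′ = τ ∘ punchIn (suc zero)
  pair⊆image : Pair p q ⊆ Image τ
  pair⊆image (inj₁ refl) = zero , refl
  pair⊆image (inj₂ refl) = suc zero , refl
  pair? : Decidable (Pair p q)
  pair? j = (j Fin.≟ p) ⊎-dec (j Fin.≟ q)
  image′⊆image : Image τ′ ⊆ Image τ
  image′⊆image (b , refl) = punchIn (suc zero) b , refl
  image′? : Decidable (Image τ′)
  image′? j = Fin.any? (λ b → τ′ b Fin.≟ j)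
  q∉image′ : ¬ Image τ′ q
  q∉image′ (b , τ′b≡q) = Fin.punchInᵢ≢i (suc zero) b (τ-injective τ′b≡q)

-- Rank

Echelon : ∀ {ρ n} → (Fin ρ → Fin n) → (Fin ρ → Vector ℤ n) → Set
Echelon {zero}  ι X = ⊤
Echelon {suc ρ} ι X =
  X zero (ι zero) ≢ 0ℤ × (∀ a → X (suc a) (ι zero) ≡ 0ℤ) × Echelon (ι ∘ suc) (X ∘ suc)

echelon-cong : ∀ {ρ n} (ι : Fin ρ → Fin n) {X Y : Fin ρ → Vector ℤ n} →
               (∀ a a′ → X a (ι a′) ≡ Y a (ι a′)) → Echelon ι X → Echelon ι Y
echelon-cong {zero}  ι X≡Y tt = tt
echelon-cong {suc ρ} ι X≡Y (lead≢0 , below≡0 , rest) =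
  lead≢0 ∘ trans (X≡Y zero zero) ,
  (λ a → trans (sym (X≡Y (suc a) zero)) (below≡0 a)) ,
  echelon-cong (ι ∘ suc) (λ a a′ → X≡Y (suc a) (suc a′)) rest

echelon⇒independent : ∀ {ρ n} (ι : Fin ρ → Fin n) (X : Fin ρ → Vector ℤ n) → Echelon ι X →
                      ∀ c → (∀ j → rowComb X c j ≡ 0ℤ) → ∀ a → c a ≡ 0ℤ
echelon⇒independent {suc ρ} ι X (lead≢0 , below≡0 , rest) c comb≡0 = c≡0
  where
  lead-term≡0 : c zero * X zero (ι zero) ≡ 0ℤ
  lead-term≡0 = begin
    c zero * X zero (ι zero)         ≡⟨ sym (ℤ.+-identityʳ _) ⟩
    c zero * X zero (ι zero) + 0ℤ    ≡⟨ cong (λ s → c zero * X zero (ι zero) + s)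
                                          (sym (sumℤ-zero (λ a → trans (cong (c (suc a) *_) (below≡0 a)) (ℤ.*-zeroʳ (c (suc a)))))) ⟩
    rowComb X c (ι zero)             ≡⟨ comb≡0 (ι zero) ⟩
    0ℤ                               ∎
  c₀≡0 : c zero ≡ 0ℤ
  c₀≡0 with ℤ.i*j≡0⇒i≡0∨j≡0 (c zero) lead-term≡0
  ... | inj₁ c₀≡0 = c₀≡0
  ... | inj₂ X≡0  = ⊥-elim (lead≢0 X≡0)
  tail-comb≡0 : ∀ j → rowComb (X ∘ suc) (c ∘ suc) j ≡ 0ℤ
  tail-comb≡0 j = begin
    rowComb (X ∘ suc) (c ∘ suc) j                ≡⟨ sym (ℤ.+-identityˡ _) ⟩
    0ℤ + rowComb (X ∘ suc) (c ∘ suc) j           ≡⟨ cong (_+ rowComb (X ∘ suc) (c ∘ suc) j)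
                                                      (sym (trans (cong (_* X zero j) c₀≡0) (ℤ.*-zeroˡ (X zero j)))) ⟩
    rowComb X c j                                ≡⟨ comb≡0 j ⟩
    0ℤ                                           ∎
  c≡0 : ∀ a → c a ≡ 0ℤ
  c≡0 zero    = c₀≡0
  c≡0 (suc a) = echelon⇒independent (ι ∘ suc) (X ∘ suc) rest (c ∘ suc) tail-comb≡0 a

VanishOff : ∀ {ρ n} → (Fin ρ → Fin n) → Vector ℤ n → Set
VanishOff ι y = ∀ j → (∀ a → ι a ≢ j) → y j ≡ 0ℤ

Dependent : ∀ {m n} → (Fin m → Vector ℤ n) → Set
Dependent Y = ∃ λ c → (∀ j → rowComb Y c j ≡ 0ℤ) × ∃ λ i → c i ≢ 0ℤ

dependent-tail : ∀ {m n} (Y : Fin (suc m) → Vector ℤ n) → Dependent (Y ∘ suc) → Dependent Y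
dependent-tail Y (c , comb≡0 , i , cᵢ≢0) =
  0ℤ ∷ c ,
  (λ j → trans (cong (_+ rowComb (Y ∘ suc) c j) (ℤ.*-zeroˡ (Y zero j)))
               (trans (ℤ.+-identityˡ _) (comb≡0 j))) ,
  suc i , cᵢ≢0

module Elimination {m n} (Y : Fin (suc m) → Vector ℤ n) (pv : Fin (suc m)) (P : Fin n) where

  A : ℤ
  A = Y pv P

  Y′ : Fin m → Vector ℤ n
  Y′ i j = A * Y (punchIn pv i) j - Y (punchIn pv i) P * Y pv j

  Y′-vanishes : ∀ i → Y′ i P ≡ 0ℤ
  Y′-vanishes i = solve 2 (λ a b → a :* b :- b :* a := con 0ℤ) refl A (Y (punchIn pv i) P)

  lift : Vector ℤ m → Vector ℤ (suc m)
  lift c = insertAt (λ i → A * c i) pv (- sumℤ (λ i → c i * Y (punchIn pv i) P))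

  rowComb-lift : ∀ c j → rowComb Y (lift c) j ≡ rowComb Y′ c j
  rowComb-lift c j = begin
    rowComb Y (lift c) j
      ≡⟨ sumℤ-remove (λ i → lift c i * Y i j) pv ⟩
    lift c pv * z + sumℤ (λ i → lift c (punchIn pv i) * y i j)
      ≡⟨ cong₂ (λ a t → a * z + t) (insertAt-lookup _ pv _)
               (sumℤ-cong (λ i → cong (_* y i j) (insertAt-punchIn _ pv _ i))) ⟩
    - S * z + T
      ≡⟨ solve 3 (λ S z T → :- S :* z :+ T := T :+ S :* (:- z)) refl S z T ⟩
    T + S * (- z)
      ≡⟨ cong (λ s → T + s) (*-distribʳ-sumℤ (- z) (λ i → c i * b i)) ⟩
    T + sumℤ (λ i → c i * b i * (- z))
      ≡⟨ sym (sumℤ-+ (λ i → A * c i * y i j) (λ i → c i * b i * (- z))) ⟩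
    sumℤ (λ i → A * c i * y i j + c i * b i * (- z))
      ≡⟨ sumℤ-cong (λ i → regroup A (c i) (y i j) (b i) z) ⟩
    rowComb Y′ c j ∎
    where
    y : Fin m → Vector ℤ n
    y i = Y (punchIn pv i)
    b : Vector ℤ m
    b i = y i P
    z S T : ℤ
    z = Y pv j
    S = sumℤ (λ i → c i * b i)
    T = sumℤ (λ i → A * c i * y i j)
    regroup : ∀ A c y b z → A * c * y + c * b * (- z) ≡ c * (A * y - b * z)
    regroup = solve 5 (λ A c y b z → A :* c :* y :+ c :* b :* (:- z) := c :* (A :* y :- b :* z)) refl

  dependent-lift : A ≢ 0ℤ → Dependent Y′ → Dependent Y
  dependent-lift A≢0 (c , comb≡0 , i , cᵢ≢0) =
    lift c , (λ j → trans (rowComb-lift c j) (comb≡0 j)) , punchIn pv i , lift≢0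
    where
    lift≢0 : lift c (punchIn pv i) ≢ 0ℤ
    lift≢0 liftᵢ≡0 with ℤ.i*j≡0⇒i≡0∨j≡0 A (trans (sym (insertAt-punchIn _ pv _ i)) liftᵢ≡0)
    ... | inj₁ A≡0  = A≢0 A≡0
    ... | inj₂ cᵢ≡0 = cᵢ≢0 cᵢ≡0

vanishOff⇒dependent : ∀ ρ {n} (ι : Fin ρ → Fin n) (Y : Fin (suc ρ) → Vector ℤ n) →
                      (∀ i → VanishOff ι (Y i)) → Dependent Y
vanishOff⇒dependent zero ι Y vanish =
  const 1ℤ ,
  (λ j → sumℤ-zero (λ i → trans (cong (1ℤ *_) (vanish i j (λ ()))) (ℤ.*-zeroʳ 1ℤ))) ,
  zero , (λ ())
vanishOff⇒dependent (suc ρ) {n} ι Y vanish with Fin.all? (λ i → Y i (ι zero) ℤ.≟ 0ℤ)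
... | yes Y≡0 = dependent-tail Y (vanishOff⇒dependent ρ (ι ∘ suc) (Y ∘ suc) (λ i → vanishOff-tail (Y≡0 (suc i)) (vanish (suc i))))
  where
  vanishOff-tail : ∀ {y} → y (ι zero) ≡ 0ℤ → VanishOff ι y → VanishOff (ι ∘ suc) y
  vanishOff-tail {y} y≡0 y-vanish j j∉ι with ι zero Fin.≟ j
  ... | yes refl = y≡0
  ... | no ι₀≢j  = y-vanish j λ { zero → ι₀≢j ; (suc a) → j∉ι a }
... | no ¬Y≡0 = eliminate (Fin.¬∀⟶∃¬ _ _ (λ i → Y i (ι zero) ℤ.≟ 0ℤ) ¬Y≡0)
  where
  eliminate : (∃ λ pv → Y pv (ι zero) ≢ 0ℤ) → Dependent Y
  eliminate (pv , A≢0) = dependent-lift A≢0 (vanishOff⇒dependent ρ (ι ∘ suc) Y′ Y′-vanishOff)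
    where
    open Elimination Y pv (ι zero)
    Y′-vanishOff : ∀ i → VanishOff (ι ∘ suc) (Y′ i)
    Y′-vanishOff i j j∉ι with ι zero Fin.≟ j
    ... | yes refl = Y′-vanishes i
    ... | no ι₀≢j  = begin
      A * Y (punchIn pv i) j - Y (punchIn pv i) (ι zero) * Y pv j
        ≡⟨ cong₂ (λ u w → A * u - Y (punchIn pv i) (ι zero) * w) (Y-vanish (punchIn pv i)) (Y-vanish pv) ⟩
      A * 0ℤ - Y (punchIn pv i) (ι zero) * 0ℤ
        ≡⟨ solve 2 (λ a b → a :* con 0ℤ :- b :* con 0ℤ := con 0ℤ) refl A (Y (punchIn pv i) (ι zero)) ⟩
      0ℤ ∎
      where
      Y-vanish : ∀ k → Y k j ≡ 0ℤ
      Y-vanish k = vanish k j λ { zero → ι₀≢j ; (suc a) → j∉ι a }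

-- Row reduction

record Partition (n ρ t : ℕ) : Set where
  field
    pivot          : Fin ρ → Fin n
    free           : Fin t → Fin n
    size           : ρ ℕ.+ t ≡ n
    pivot≢free     : ∀ a b → pivot a ≢ free b
    free-injective : Injective _≡_ _≡_ free
    pivot-or-free  : ∀ j → Image pivot j ⊎ Image free j
open Partition public

allFree : ∀ n → Partition n 0 n
allFree n = record
  { pivot = λ () ; free = λ j → j ; size = refl ; pivot≢free = λ ()
  ; free-injective = λ j≡j′ → j≡j′ ; pivot-or-free = λ j → inj₂ (j , refl) }

freeToPivot : ∀ {n ρ t} → Partition n ρ (suc t) → Partition n (suc ρ) t
freeToPivot {ρ = ρ} {t} π = record
  { pivot          = free π zero ∷ pivot π
  ; free           = free π ∘ suc
  ; size           = trans (sym (ℕ.+-suc ρ t)) (size π)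
  ; pivot≢free     = λ { zero b → Fin.0≢1+n ∘ free-injective π ; (suc a) b → pivot≢free π a (suc b) }
  ; free-injective = Fin.suc-injective ∘ free-injective π
  ; pivot-or-free  = reclassify ∘ pivot-or-free π
  }
  where
  reclassify : ∀ {j} → Image (pivot π) j ⊎ Image (free π) j →
               Image (free π zero ∷ pivot π) j ⊎ Image (free π ∘ suc) j
  reclassify (inj₁ (a , e))     = inj₁ (suc a , e)
  reclassify (inj₂ (zero , e))  = inj₁ (zero , e)
  reclassify (inj₂ (suc b , e)) = inj₂ (b , e)

vanishOff-pivots : ∀ {n ρ t} (π : Partition n ρ t) {y : Vector ℤ n} →
                   (∀ b → y (free π b) ≡ 0ℤ) → VanishOff (pivot π) y
vanishOff-pivots π y≡0 j j∉pivot with pivot-or-free π j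
... | inj₁ (a , refl) = ⊥-elim (j∉pivot a refl)
... | inj₂ (b , refl) = y≡0 b

module Reduction {R n} (L : Fin R → Vector ℤ n) (L-saturated : Saturated L) where

  record Reduced {r} (M : Fin r → Vector ℤ n) (ρ t : ℕ) : Set where
    field
      partition   : Partition n ρ t
      basis       : Basis n
      vanish-free : ∀ i b → coord basis (M i) (free partition b) ≡ 0ℤ
      pivot-in-L  : ∀ a → InRowSpan L (vec basis (pivot partition a))
      selected    : Fin ρ → Fin r
      echelon     : Echelon (pivot partition) (coord basis ∘ M ∘ selected)

  reduced-empty : (M : Fin 0 → Vector ℤ n) → Reduced M 0 n
  reduced-empty M = record
    { partition = allFree n ; basis = standardBasis n ; vanish-free = λ ()
    ; pivot-in-L = λ () ; selected = λ () ; echelon = tt }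

  module _ {r} {M : Fin (suc r) → Vector ℤ n} where

    extend-noFree : ∀ {ρ} → Reduced (M ∘ suc) ρ 0 → Reduced M ρ 0
    extend-noFree R = record
      { partition = partition ; basis = basis ; vanish-free = λ { zero () ; (suc i) → vanish-free i }
      ; pivot-in-L = pivot-in-L ; selected = suc ∘ selected ; echelon = echelon }
      where open Reduced R

    module Extend (M₀∈L : InRowSpan L (M zero)) {ρ k} (R : Reduced (M ∘ suc) ρ (suc k)) where
      open Reduced R

      π : Partition n ρ (suc k)
      π = partition

      v : Vector ℤ n
      v = M zero

      concentrated : ∃ λ B′ → ChangeWithin (Image (free π)) basis B′ × ∀ b → coord B′ v (free π (suc b)) ≡ 0ℤ
      concentrated = concentrate basis (free π) (free-injective π) v

      B′ : Basis n
      B′ = proj₁ concentrated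

      change : ChangeWithin (Image (free π)) basis B′
      change = proj₁ (proj₂ concentrated)

      v-concentrated : ∀ b → coord B′ v (free π (suc b)) ≡ 0ℤ
      v-concentrated = proj₂ (proj₂ concentrated)

      g : ℤ
      g = coord B′ v (free π zero)

      pivot∉free : ∀ a → ¬ Image (free π) (pivot π a)
      pivot∉free a (b , e) = pivot≢free π a b (sym e)

      old-vanish : ∀ i b → coord B′ (M (suc i)) (free π b) ≡ 0ℤ
      old-vanish i b = zero-on change (M (suc i)) (λ { (b′ , refl) → vanish-free i b′ }) (b , refl)

      old-pivot-in-L : ∀ a → InRowSpan L (vec B′ (pivot π a))
      old-pivot-in-L a = span-cong L (λ k → sym (vec-off change (pivot∉free a) k)) (pivot-in-L a)

      old-echelon : Echelon (pivot π) (coord B′ ∘ M ∘ suc ∘ selected)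
      old-echelon = echelon-cong (pivot π) (λ a a′ → sym (coord-off change (pivot∉free a′) (M (suc (selected a))))) echelon

      absorb : g ≡ 0ℤ → Reduced M ρ (suc k)
      absorb g≡0 = record
        { partition   = π
        ; basis       = B′
        ; vanish-free = λ { zero zero → g≡0 ; zero (suc b) → v-concentrated b ; (suc i) → old-vanish i }
        ; pivot-in-L  = old-pivot-in-L
        ; selected    = suc ∘ selected
        ; echelon     = old-echelon
        }

      new-pivot-in-L : g ≢ 0ℤ → InRowSpan L (vec B′ (free π zero))
      new-pivot-in-L g≢0 = L-saturated _ g g≢0 (span-cong L v-minus-others (span-− L M₀∈L others∈L))
        where
        p : Fin n
        p = free π zero
        x x′ : Vector ℤ n
        x = coord B′ v
        x′ = updateAt x p (const 0ℤ)
        others∈L : InRowSpan L (rowComb (vec B′) x′)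
        others∈L = span-rowComb L (vec B′) x′ spanned
          where
          spanned : ∀ j → x′ j ≡ 0ℤ ⊎ InRowSpan L (vec B′ j)
          spanned j with j Fin.≟ p | pivot-or-free π j
          ... | yes refl | _                  = inj₁ (updateAt-updates p x)
          ... | no j≢p  | inj₁ (a , refl)     = inj₂ (old-pivot-in-L a)
          ... | no j≢p  | inj₂ (zero , refl)  = ⊥-elim (j≢p refl)
          ... | no j≢p  | inj₂ (suc b , refl) = inj₁ (trans (updateAt-minimal _ p x j≢p) (v-concentrated b))
        v-minus-others : ∀ j → v j - rowComb (vec B′) x′ j ≡ g * vec B′ p j
        v-minus-others j = begin
          v j - rowComb (vec B′) x′ j
            ≡⟨ cong (_- rowComb (vec B′) x′ j) (sym (expand B′ v j)) ⟩
          rowComb (vec B′) x j - rowComb (vec B′) x′ j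
            ≡⟨ cong (_- rowComb (vec B′) x′ j) (rowComb-erase (vec B′) x p j) ⟩
          g * vec B′ p j + rowComb (vec B′) x′ j - rowComb (vec B′) x′ j
            ≡⟨ solve 2 (λ a b → a :+ b :- b := a) refl (g * vec B′ p j) (rowComb (vec B′) x′ j) ⟩
          g * vec B′ p j ∎

      promote : g ≢ 0ℤ → Reduced M (suc ρ) k
      promote g≢0 = record
        { partition   = freeToPivot π
        ; basis       = B′
        ; vanish-free = λ { zero b → v-concentrated b ; (suc i) b → old-vanish i (suc b) }
        ; pivot-in-L  = λ { zero → new-pivot-in-L g≢0 ; (suc a) → old-pivot-in-L a }
        ; selected    = zero ∷ suc ∘ selected
        ; echelon     = g≢0 , (λ a → old-vanish (selected a) zero) , old-echelon
        }

  extend : ∀ {r ρ t} {M : Fin (suc r) → Vector ℤ n} → InRowSpan L (M zero) →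
           Reduced (M ∘ suc) ρ t → ∃₂ (Reduced M)
  extend {t = zero}  M₀∈L R = _ , _ , extend-noFree R
  extend {t = suc k} {M} M₀∈L R with Extend.g {M = M} M₀∈L R ℤ.≟ 0ℤ
  ... | yes g≡0 = _ , _ , Extend.absorb {M = M} M₀∈L R g≡0
  ... | no g≢0  = _ , _ , Extend.promote {M = M} M₀∈L R g≢0

  reduce : ∀ {r} (M : Fin r → Vector ℤ n) → (∀ i → InRowSpan L (M i)) → ∃₂ (Reduced M)
  reduce {zero}  M M∈L = 0 , n , reduced-empty M
  reduce {suc r} M M∈L = extend (M∈L zero) (proj₂ (proj₂ (reduce (M ∘ suc) (M∈L ∘ suc))))

  reduced⇒hasRank : ∀ {r ρ t} {M : Fin r → Vector ℤ n} → Reduced M ρ t → HasRank M ρ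
  reduced⇒hasRank {ρ = ρ} {M = M} R = (selected , independent) , dependent
    where
    open Reduced R
    independent : RowsIndependent M selected
    independent c comb≡0 = echelon⇒independent (pivot partition) (coord basis ∘ M ∘ selected) echelon c
      (λ j → trans (sym (coord-rowComb basis (M ∘ selected) c j)) (≡0⇒coord≡0 basis comb≡0 j))
    dependent : ∀ s → ¬ RowsIndependent M s
    dependent s s-independent =
      let c , comb≡0 , i , cᵢ≢0 = vanishOff⇒dependent ρ (pivot partition) (coord basis ∘ M ∘ s)
                                    (λ i → vanishOff-pivots partition (vanish-free (s i)))
      in  cᵢ≢0 (s-independent c (coord≡0⇒≡0 basis (λ j → trans (coord-rowComb basis (M ∘ s) c j) (comb≡0 j))) i)

-- Framing a quiver

_⁺ : ℤ → ℕ
(+ m)    ⁺ = m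
-[1+ m ] ⁺ = 0

⁺≢0⇒-⁺≡0 : ∀ x → x ⁺ ≢ 0 → (- x) ⁺ ≡ 0
⁺≢0⇒-⁺≡0 (+ zero)  x⁺≢0 = ⊥-elim (x⁺≢0 refl)
⁺≢0⇒-⁺≡0 (+ suc m) _    = refl
⁺≢0⇒-⁺≡0 -[1+ m ]  x⁺≢0 = ⊥-elim (x⁺≢0 refl)

⁺-⁺ : ∀ x → + (x ⁺) - + ((- x) ⁺) ≡ x
⁺-⁺ (+ zero)  = refl
⁺-⁺ (+ suc m) = ℤ.+-identityʳ (+ suc m)
⁺-⁺ -[1+ m ]  = refl

module _ {n m} (Q : Quiver n) (C : Fin m → Vector ℤ n) where

  private
    arrows′ : Fin n ⊎ Fin m → Fin n ⊎ Fin m → ℕ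
    arrows′ (inj₁ i) (inj₁ j) = arrows Q i j
    arrows′ (inj₂ f) (inj₁ j) = (C f j) ⁺
    arrows′ (inj₁ i) (inj₂ f) = (- C f i) ⁺
    arrows′ (inj₂ _) (inj₂ _) = 0

    noLoop′ : ∀ x → arrows′ x x ≡ 0
    noLoop′ (inj₁ i) = noLoop Q i
    noLoop′ (inj₂ f) = refl

    no2cycle′ : ∀ x y → arrows′ x y ≢ 0 → arrows′ y x ≡ 0
    no2cycle′ (inj₁ i) (inj₁ j) = no2cycle Q i j
    no2cycle′ (inj₂ f) (inj₁ j) = ⁺≢0⇒-⁺≡0 (C f j)
    no2cycle′ (inj₁ i) (inj₂ f) = λ -C⁺≢0 → subst (λ x → x ⁺ ≡ 0) (ℤ.neg-involutive (C f i)) (⁺≢0⇒-⁺≡0 (- C f i) -C⁺≢0)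
    no2cycle′ (inj₂ _) (inj₂ _) _ = refl

  frame : IceQuiver n m
  frame = record
    { quiver   = record
      { arrows   = λ i j → arrows′ (splitAt n i) (splitAt n j)
      ; noLoop   = λ i → noLoop′ (splitAt n i)
      ; no2cycle = λ i j → no2cycle′ (splitAt n i) (splitAt n j)
      }
    ; noFrozen = λ f f′ → cong₂ arrows′ (Fin.splitAt-↑ʳ n m f) (Fin.splitAt-↑ʳ n m f′)
    }

  frame-mutablePart : MutablePartIs frame Q
  frame-mutablePart i j = cong₂ arrows′ (Fin.splitAt-↑ˡ n i m) (Fin.splitAt-↑ˡ n j m)

  exchangeMatrix-mutable : ∀ i → exchangeMatrix frame (i ↑ˡ m) ≗ B Q i
  exchangeMatrix-mutable i j rewrite Fin.splitAt-↑ˡ n i m | Fin.splitAt-↑ˡ n j m = refl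

  exchangeMatrix-frozen : ∀ f → exchangeMatrix frame (n ↑ʳ f) ≗ C f
  exchangeMatrix-frozen f j rewrite Fin.splitAt-↑ʳ n m f | Fin.splitAt-↑ˡ n j m = ⁺-⁺ (C f j)

  frame-reallyFullRank : (basis : Basis n) →
                         (∀ j → InRowSpan (B Q) (vec basis j) ⊎ ∃ λ f → C f ≗ vec basis j) →
                         ReallyFullRank frame
  frame-reallyFullRank basis spanned w = span-byCoords E basis (inj₂ ∘ spanned′)
    where
    E : Fin (n ℕ.+ m) → Fin n → ℤ
    E = exchangeMatrix frame
    spanned′ : ∀ j → InRowSpan E (vec basis j)
    spanned′ j with spanned j
    ... | inj₁ u∈B = span-⊆ E (B Q) (λ i → span-cong E (exchangeMatrix-mutable i) (span-row E (i ↑ˡ m))) u∈B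
    ... | inj₂ (f , C≗u) = span-cong E (λ k → trans (exchangeMatrix-frozen f k) (C≗u k)) (span-row E (n ↑ʳ f))


module _ {n} (Q : Quiver n) (torsionFree : TorsionFree Q) where
  open Reduction (B Q) torsionFree

  reduced⇒minimalExtension : ∀ {ρ t} → Reduced (B Q) ρ t → MinimalExtension Q
  reduced⇒minimalExtension {ρ} {t} R =
    t , (ρ , reduced⇒hasRank R , corank) ,
    frame Q frozenRows , frame-mutablePart Q frozenRows , frame-reallyFullRank Q frozenRows basis spanned
    where
    open Reduced R
    frozenRows : Fin t → Vector ℤ n
    frozenRows = vec basis ∘ free partition
    corank : t ≡ n ℕ.∸ ρ
    corank = trans (sym (ℕ.m+n∸m≡n ρ t)) (cong (ℕ._∸ ρ) (size partition))
    spanned : ∀ j → InRowSpan (B Q) (vec basis j) ⊎ ∃ λ f → frozenRows f ≗ vec basis j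
    spanned j with pivot-or-free partition j
    ... | inj₁ (a , refl) = inj₁ (pivot-in-L a)
    ... | inj₂ (b , refl) = inj₂ (b , λ _ → refl)

lemma5p2 : ∀ (n : ℕ) (Q : Quiver n) → TorsionFree Q → MinimalExtension Q
lemma5p2 n Q torsionFree =
  let _ , _ , R = Reduction.reduce (B Q) torsionFree (B Q) (span-row (B Q))
  in  reduced⇒minimalExtension Q torsionFree R
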